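{- Let $F$ be a CNF formula and let $l$ be a literal such that the single-literal clause $l$ belongs to $F$. Then $l$ is superredundant in $F$ if and only if \[ \{c \in F \mid \neg l \notin c,\ c \neq l\} \cup \{c \mid c \vee \neg l \in F\} \models l , \] where $\{c \mid c \vee \neg l \in F\}$ denotes the set of clauses $d \setminus \{\neg l\}$ for $d \in F$ with $\neg l \in d$.
   Context: A CNF formula is a finite set of clauses; a clause is a finite set of literals, read as their disjunction. Tautological clauses (containing a literal and its negation) are not allowed in formulae. Resolution: from clauses $c_1 \vee l$ and $c_2 \vee \neg l$ derive $c_1 \vee c_2$; two clauses whose resolvent would be a tautology are considered not to resolve. The resolution closure $\mathrm{ResCn}(F)$ is the set of all clauses obtainable from $F$ by zero or more resolution steps. A clause $c \in F$ is superredundant in $F$ if $\mathrm{ResCn}(F) \setminus \{c\} \models c$, and superirredundant otherwise. If $l = \neg x$ then $\neg l$ denotes $x$. -}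

module Defs where

open import Data.Nat using (ℕ)
open import Data.Bool using (Bool; true; false)
open import Data.List using (List; []; _∷_)
open import Data.List.Membership.Propositional using (_∈_; _∉_)
open import Data.List.Relation.Unary.Any using (Any)
open import Data.Product using (Σ; _×_; ∃; ∃-syntax; _,_)
open import Data.Sum using (_⊎_)
open import Relation.Binary.PropositionalEquality using (_≡_; _≢_)
open import Relation.Nullary using (¬_)
open import Function.Bundles using (_⇔_)

data Literal : Set where
  pos : ℕ → Literal
  neg : ℕ → Literal

∼_ : Literal → Literal
∼ pos x = neg x
∼ neg x = pos x

-- A clause is a finite set of literals, represented by a list;
-- lists are compared as sets (same members).
Clause : Set
Clause = List Literal

Formula : Set
Formula = List Clause

_≈ᶜ_ : Clause → Clause → Set
c ≈ᶜ d = ∀ x → (x ∈ c) ⇔ (x ∈ d)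

_∈ᶠ_ : Clause → Formula → Set
c ∈ᶠ F = ∃[ d ] (d ∈ F × c ≈ᶜ d)

Tautology : Clause → Set
Tautology c = ∃[ x ] (x ∈ c × (∼ x) ∈ c)

WellFormed : Formula → Set
WellFormed F = ∀ c → c ∈ F → ¬ Tautology c

Assignment : Set
Assignment = ℕ → Bool

satLit : Assignment → Literal → Set
satLit α (pos x) = α x ≡ true
satLit α (neg x) = α x ≡ false

satClause : Assignment → Clause → Set
satClause α c = ∃[ x ] (x ∈ c × satLit α x)

ClauseSet : Set₁
ClauseSet = Clause → Set

_⊨_ : ClauseSet → Clause → Set
S ⊨ c = ∀ (α : Assignment) → (∀ d → S d → satClause α d) → satClause α c

IsResolvent : Clause → Literal → Clause → Clause → Set
IsResolvent c₁ l c₂ r =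
  ∀ x → (x ∈ r) ⇔ ((x ∈ c₁ × x ≢ l) ⊎ (x ∈ c₂ × x ≢ ∼ l))

data ResCn (F : Formula) : Clause → Set where
  base : ∀ {c} → c ∈ᶠ F → ResCn F c
  resolve : ∀ {c₁ c₂ r} (l : Literal) →
            ResCn F c₁ → ResCn F c₂ → l ∈ c₁ → (∼ l) ∈ c₂ →
            IsResolvent c₁ l c₂ r → ¬ Tautology r → ResCn F r

Superredundant : Formula → Clause → Set
Superredundant F c = (λ d → ResCn F d × ¬ (d ≈ᶜ c)) ⊨ c

ReducedSet : Formula → Literal → ClauseSet
ReducedSet F l c =
  (c ∈ᶠ F × (∼ l) ∉ c × ¬ (c ≈ᶜ (l ∷ [])))
  ⊎ (∃[ d ] (d ∈ F × (∼ l) ∈ d × (∀ x → (x ∈ c) ⇔ (x ∈ d × x ≢ ∼ l))))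

{-# OPTIONS --safe #-}
-- Fix α satisfying the reduced set.  Every clause of ResCn F is either the
-- unit clause l or is made true by α through a literal other than ∼ l: this
-- holds on F (a clause containing ∼ l is true through its reduct), and it is
-- preserved by resolution, since two such clauses cannot clash on a literal
-- true in both.  So α satisfies ResCn F ∖ {l}.  Conversely each reduct
-- d ∖ {∼ l} is the resolvent of l with d, and is neither l nor a tautology
-- because d is not a tautology.

module Submission where

open import Defs
open import Data.Nat as ℕ using ()
open import Data.List using ([]; _∷_; filter)
open import Data.List.Relation.Unary.Any using (here)
open import Data.List.Relation.Unary.All as All using (All; all?)
open import Data.List.Membership.Propositional using (_∈_)
open import Data.List.Membership.Propositional.Properties using (∈-filter⁺; ∈-filter⁻)
open import Data.Product using (_×_; _,_; proj₁; ∃-syntax)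
open import Data.Sum using (_⊎_; inj₁; inj₂)
open import Data.Empty using (⊥-elim)
open import Function using (id; _∘_)
open import Function.Bundles using (_⇔_; mk⇔; Equivalence)
open import Relation.Nullary using (¬_; Dec; yes; no)
open import Relation.Nullary.Decidable using (¬?; _×-dec_; map′)
open import Relation.Binary.PropositionalEquality using (_≡_; _≢_; refl; sym; trans; cong; subst)
open Equivalence

infix 4 _≟ˡ_
_≟ˡ_ : (x y : Literal) → Dec (x ≡ y)
pos x ≟ˡ pos y = map′ (cong pos) (λ { refl → refl }) (x ℕ.≟ y)
neg x ≟ˡ neg y = map′ (cong neg) (λ { refl → refl }) (x ℕ.≟ y)
pos _ ≟ˡ neg _ = no λ ()
neg _ ≟ˡ pos _ = no λ ()

open import Data.List.Membership.DecPropositional _≟ˡ_ using (_∈?_)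

∼-involutive : ∀ x → ∼ (∼ x) ≡ x
∼-involutive (pos _) = refl
∼-involutive (neg _) = refl

∼-irreflexive : ∀ x → ∼ x ≢ x
∼-irreflexive (pos _) ()
∼-irreflexive (neg _) ()

satLit-∼ : ∀ α x → satLit α x → ¬ satLit α (∼ x)
satLit-∼ α (pos _) p q with trans (sym p) q
... | ()
satLit-∼ α (neg _) p q with trans (sym p) q
... | ()

≈ᶜ-refl : ∀ {c} → c ≈ᶜ c
≈ᶜ-refl _ = mk⇔ id id

≈ᶜ-trans : ∀ {c d e} → c ≈ᶜ d → d ≈ᶜ e → c ≈ᶜ e
≈ᶜ-trans p q x = mk⇔ (to (q x) ∘ to (p x)) (from (p x) ∘ from (q x))

∈-unit : ∀ {c l x} → c ≈ᶜ (l ∷ []) → x ∈ c → x ≡ l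
∈-unit e x∈c with to (e _) x∈c
... | here x≡l = x≡l

≈ᶜ-unit? : ∀ c l → Dec (c ≈ᶜ (l ∷ []))
≈ᶜ-unit? c l = map′ unit (λ e → All.tabulate (∈-unit e) , from (e l) (here refl))
                     (all? (_≟ˡ l) c ×-dec l ∈? c)
  where
    unit : All (_≡ l) c × l ∈ c → c ≈ᶜ (l ∷ [])
    unit (all≡l , l∈c) x = mk⇔ (here ∘ All.lookup all≡l) λ { (here refl) → l∈c }

removeLit : Literal → Clause → Clause
removeLit y = filter (λ x → ¬? (x ≟ˡ y))

∈-removeLit : ∀ y c x → x ∈ removeLit y c ⇔ (x ∈ c × x ≢ y)
∈-removeLit y c x = mk⇔ (∈-filter⁻ x≢y? {xs = c}) (λ (x∈c , x≢y) → ∈-filter⁺ x≢y? x∈c x≢y)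
  where
    x≢y? : ∀ x → Dec (x ≢ y)
    x≢y? x = ¬? (x ≟ˡ y)

SatisfiedWithout : Assignment → Literal → Clause → Set
SatisfiedWithout α y c = ∃[ x ] (x ∈ c × x ≢ y × satLit α x)

UnitOrSatisfied : Assignment → Literal → Clause → Set
UnitOrSatisfied α l c = c ≈ᶜ (l ∷ []) ⊎ SatisfiedWithout α (∼ l) c

UnitOrSatisfied-resp-≈ᶜ : ∀ {α l c d} → c ≈ᶜ d → UnitOrSatisfied α l d → UnitOrSatisfied α l c
UnitOrSatisfied-resp-≈ᶜ e (inj₁ u) = inj₁ (≈ᶜ-trans e u)
UnitOrSatisfied-resp-≈ᶜ e (inj₂ (x , x∈d , x≢ , sx)) = inj₂ (x , from (e x) x∈d , x≢ , sx)

UnitOrSatisfied-resolvent : ∀ {α l c₁ c₂ r} m → m ∈ c₁ → ∼ m ∈ c₂ → IsResolvent c₁ m c₂ r →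
  UnitOrSatisfied α l c₁ → UnitOrSatisfied α l c₂ → UnitOrSatisfied α l r
UnitOrSatisfied-resolvent {α} {l} {c₁} {c₂} {r} m m∈c₁ ∼m∈c₂ res = step
  where
    from₁ : ∀ {x} → x ∈ c₁ → x ≢ m → x ∈ r
    from₁ x∈c₁ x≢m = from (res _) (inj₁ (x∈c₁ , x≢m))
    from₂ : ∀ {x} → x ∈ c₂ → x ≢ ∼ m → x ∈ r
    from₂ x∈c₂ x≢∼m = from (res _) (inj₂ (x∈c₂ , x≢∼m))

    step : UnitOrSatisfied α l c₁ → UnitOrSatisfied α l c₂ → UnitOrSatisfied α l r
    step (inj₁ u₁) (inj₁ u₂) =
      ⊥-elim (∼-irreflexive l (trans (cong ∼_ (sym (∈-unit u₁ m∈c₁))) (∈-unit u₂ ∼m∈c₂)))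
    step (inj₁ u₁) (inj₂ (y , y∈c₂ , y≢ , sy)) =
      inj₂ (y , from₂ y∈c₂ (λ y≡∼m → y≢ (trans y≡∼m (cong ∼_ (∈-unit u₁ m∈c₁)))) , y≢ , sy)
    step (inj₂ (x , x∈c₁ , x≢ , sx)) (inj₁ u₂) =
      inj₂ (x , from₁ x∈c₁ (λ x≡m → x≢ (trans x≡m m≡∼l)) , x≢ , sx)
      where
        m≡∼l : m ≡ ∼ l
        m≡∼l = trans (sym (∼-involutive m)) (cong ∼_ (∈-unit u₂ ∼m∈c₂))
    step (inj₂ (x , x∈c₁ , x≢ , sx)) (inj₂ (y , y∈c₂ , y≢ , sy)) with x ≟ˡ m
    ... | no x≢m = inj₂ (x , from₁ x∈c₁ x≢m , x≢ , sx)
    ... | yes refl = inj₂ (y , from₂ y∈c₂ (λ { refl → satLit-∼ α x sx sy }) , y≢ , sy)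

ResCn-UnitOrSatisfied : ∀ {F α l} → (∀ d → d ∈ F → UnitOrSatisfied α l d) →
  ∀ {c} → ResCn F c → UnitOrSatisfied α l c
ResCn-UnitOrSatisfied onF (base (d , d∈F , c≈d)) = UnitOrSatisfied-resp-≈ᶜ c≈d (onF d d∈F)
ResCn-UnitOrSatisfied onF (resolve m p₁ p₂ m∈c₁ ∼m∈c₂ res _) =
  UnitOrSatisfied-resolvent m m∈c₁ ∼m∈c₂ res
    (ResCn-UnitOrSatisfied onF p₁) (ResCn-UnitOrSatisfied onF p₂)

ReducedSet-model-UnitOrSatisfied : ∀ {F l α} → (∀ d → ReducedSet F l d → satClause α d) →
  ∀ d → d ∈ F → UnitOrSatisfied α l d
ReducedSet-model-UnitOrSatisfied {l = l} model d d∈F with ∼ l ∈? d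
... | yes ∼l∈d =
  let (x , x∈ , sx) = model (removeLit (∼ l) d) (inj₂ (d , d∈F , ∼l∈d , ∈-removeLit (∼ l) d))
      (x∈d , x≢∼l) = to (∈-removeLit (∼ l) d x) x∈
  in inj₂ (x , x∈d , x≢∼l , sx)
... | no ∼l∉d with ≈ᶜ-unit? d l
...   | yes u = inj₁ u
...   | no ¬u =
  let (x , x∈d , sx) = model d (inj₁ ((d , d∈F , ≈ᶜ-refl) , ∼l∉d , ¬u))
  in inj₂ (x , x∈d , (λ x≡∼l → ∼l∉d (subst (_∈ d) x≡∼l x∈d)) , sx)

ReducedSet⊆ResCn : ∀ {F l} → WellFormed F → (l ∷ []) ∈ᶠ F →
  ∀ {c} → ReducedSet F l c → ResCn F c × ¬ (c ≈ᶜ (l ∷ []))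
ReducedSet⊆ResCn _ _ (inj₁ (c∈F , _ , ¬u)) = base c∈F , ¬u
ReducedSet⊆ResCn {l = l} wf l∈F {c} (inj₂ (d , d∈F , ∼l∈d , spec)) =
  resolve l (base l∈F) (base (d , d∈F , ≈ᶜ-refl)) (here refl) ∼l∈d resolvent ¬taut , ¬u
  where
    resolvent : IsResolvent (l ∷ []) l d c
    resolvent x = mk⇔ (inj₂ ∘ to (spec x))
                      λ { (inj₁ (here x≡l , x≢l)) → ⊥-elim (x≢l x≡l) ; (inj₂ q) → from (spec x) q }
    ¬taut : ¬ Tautology c
    ¬taut (x , x∈c , ∼x∈c) = wf d d∈F (x , proj₁ (to (spec x) x∈c) , proj₁ (to (spec (∼ x)) ∼x∈c))
    ¬u : ¬ (c ≈ᶜ (l ∷ []))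
    ¬u u = wf d d∈F (l , proj₁ (to (spec l) (from (u l) (here refl))) , ∼l∈d)

theorem2 : (F : Formula) (l : Literal) → WellFormed F → (l ∷ []) ∈ᶠ F →
    Superredundant F (l ∷ []) ⇔ (ReducedSet F l ⊨ (l ∷ []))
theorem2 F l wf l∈F = mk⇔ superredundant⇒reduced reduced⇒superredundant
  where
    superredundant⇒reduced : Superredundant F (l ∷ []) → ReducedSet F l ⊨ (l ∷ [])
    superredundant⇒reduced sr α model = sr α satisfied
      where
        satisfied : ∀ d → ResCn F d × ¬ (d ≈ᶜ (l ∷ [])) → satClause α d
        satisfied d (p , ¬u)
          with ResCn-UnitOrSatisfied (ReducedSet-model-UnitOrSatisfied model) p
        ... | inj₁ u = ⊥-elim (¬u u)
        ... | inj₂ (x , x∈d , _ , sx) = x , x∈d , sx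

    reduced⇒superredundant : ReducedSet F l ⊨ (l ∷ []) → Superredundant F (l ∷ [])
    reduced⇒superredundant rs α model = rs α λ d r → model d (ReducedSet⊆ResCn wf l∈F r)
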